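{- Let $G$ be a finite group, $H$ a normal subgroup and $K$ a subgroup of $G$, with either $H\cap K=\{1\}$ or $K\subseteq H$. Let $J=[HK:K]$ and let $\{t_1,\dots,t_J\}$ be a transversal for the left cosets of $K$ in $HK$. Define $\lambda:G\to\mathbb{Z}$ by $\lambda(g)=J-1$ if $g\in K$, $\lambda(g)=-1$ if $g\in HK\setminus K$, and $\lambda(g)=0$ if $g\notin HK$. Then every subset of cardinality $J-1$ of the collection of functions $\{[t_j,\lambda]: j=1,\dots,J\}$ is linearly independent (over $\mathbb{Z}$).
   Context: $HK=\{hk: h\in H, k\in K\}$ is a subgroup of $G$. Let $N=[G:K]$; $\mathbb{Z}^N$ denotes the free abelian group of functions $f:G\to\mathbb{Z}$ that are constant on each left coset of $K$ (so $\lambda\in\mathbb{Z}^N$). $G$ acts on $\mathbb{Z}^N$ by $[g,f](x)=f(g^{ -1}x)$. -}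

module Defs where

open import Level using (Level; _⊔_)
open import Algebra.Bundles using (Group)
open import Data.Nat using (ℕ; _∸_)
open import Data.Fin using (Fin; zero; suc)
open import Data.Integer using (ℤ; +_; -[1+_]; _-_; _*_; _+_)
open import Data.List using (List)
open import Data.List.Relation.Unary.Any using (Any)
open import Data.Product using (Σ; ∃; ∃₂; _×_)
open import Data.Sum using (_⊎_)
open import Relation.Nullary using (¬_)
open import Relation.Binary.PropositionalEquality using (_≡_)
open import Function.Definitions using (Injective)

Σℤ : ∀ {m} → (Fin m → ℤ) → ℤ
Σℤ {ℕ.zero} f = + 0
Σℤ {ℕ.suc m} f = f zero + Σℤ (λ i → f (suc i))

module _ {c ℓ : Level} (G : Group c ℓ) where
  open Group G using (Carrier; _≈_; _∙_; ε; _⁻¹)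

  IsFinite : Set (c ⊔ ℓ)
  IsFinite = Σ (List Carrier) λ xs → ∀ g → Any (g ≈_) xs

  record IsSubgroup {p} (S : Carrier → Set p) : Set (c ⊔ ℓ ⊔ p) where
    field
      resp  : ∀ {x y} → x ≈ y → S x → S y
      ε∈    : S ε
      ∙-closed : ∀ {x y} → S x → S y → S (x ∙ y)
      ⁻¹-closed : ∀ {x} → S x → S (x ⁻¹)

  record IsNormalSubgroup {p} (S : Carrier → Set p) : Set (c ⊔ ℓ ⊔ p) where
    field
      isSubgroup : IsSubgroup S
      normal : ∀ g {h} → S h → S ((g ∙ h) ∙ g ⁻¹)

  InProd : ∀ {p q} → (Carrier → Set p) → (Carrier → Set q) → Carrier → Set (c ⊔ ℓ ⊔ p ⊔ q)
  InProd H K g = ∃₂ λ h k → H h × K k × g ≈ h ∙ k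

  record IsLeftTransversal {p q} (H : Carrier → Set p) (K : Carrier → Set q)
                           (J : ℕ) (t : Fin J → Carrier) : Set (c ⊔ ℓ ⊔ p ⊔ q) where
    field
      inHK     : ∀ j → InProd H K (t j)
      distinct : ∀ i j → K (t i ⁻¹ ∙ t j) → i ≡ j
      covers   : ∀ g → InProd H K g → ∃ λ j → K (t j ⁻¹ ∙ g)

  IsLambda : ∀ {p q} (H : Carrier → Set p) (K : Carrier → Set q) (J : ℕ) (lam : Carrier → ℤ)
             → Set (c ⊔ ℓ ⊔ p ⊔ q)
  IsLambda H K J lam = ∀ g →
      (K g → lam g ≡ + J - + 1)
    × (InProd H K g → ¬ K g → lam g ≡ -[1+ 0 ])
    × (¬ InProd H K g → lam g ≡ + 0)

  -- Left translate [g, f](x) = f(g⁻¹ x).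
  translate : Carrier → (Carrier → ℤ) → Carrier → ℤ
  translate g f x = f (g ⁻¹ ∙ x)

  LinIndepℤ : ∀ {m} → (Fin m → Carrier → ℤ) → Set c
  LinIndepℤ {m} f = (a : Fin m → ℤ) → (∀ x → Σℤ (λ i → a i * f i x) ≡ + 0) → ∀ i → a i ≡ + 0

{-# OPTIONS --safe #-}
module Submission where

-- For a transversal, λ(tᵢ⁻¹ tⱼ) = J·δᵢⱼ − 1, so evaluating the translates [tᵢ, λ] at the
-- points tⱼ yields the rows of J·I − 𝟙.  A relation Σᵢ aᵢ [t_{s i}, λ] = 0 therefore says
-- J·cⱼ = Σᵢ aᵢ for every column j, where cⱼ is the coefficient of the row hitting j.  With
-- only J − 1 rows some column j is hit by none, so cⱼ = 0 forces Σᵢ aᵢ = 0, and then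
-- J·aᵢ = 0 for every i.

open import Defs
open import Level using (Level)
open import Algebra.Bundles using (Group)
open import Data.Bool using (if_then_else_)
open import Data.Nat using (ℕ; zero; suc; _∸_; _<_)
import Data.Nat.Properties as ℕ
open import Data.Fin using (Fin; zero; suc)
open import Data.Fin.Properties using (_≟_; suc-injective; any?; all?; ¬∀⟶∃¬; pigeonhole; <⇒≢)
open import Data.Integer using (ℤ; +_; _-_; _*_; _+_; 0ℤ; 1ℤ)
import Data.Integer.Properties as ℤ
open import Data.Integer.Tactic.RingSolver using (solve-∀)
open import Data.Product using (∃; _,_; proj₁; proj₂)
open import Data.Sum using (_⊎_; [_,_]′)
open import Function using (_∘_; id)
open import Function.Definitions using (Injective)
open import Relation.Nullary using (Dec; yes; no; does; contradiction)
open import Relation.Nullary.Decidable using (dec-true; dec-false)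
open import Relation.Binary.PropositionalEquality
  using (_≡_; _≢_; refl; sym; trans; cong; cong₂; module ≡-Reasoning)
import Algebra.Properties.Group as GroupProperties
import Relation.Binary.Reasoning.Setoid as SetoidReasoning

Σℤ-cong : ∀ {m} {f g : Fin m → ℤ} → (∀ i → f i ≡ g i) → Σℤ f ≡ Σℤ g
Σℤ-cong {zero}  _   = refl
Σℤ-cong {suc m} f≗g = cong₂ _+_ (f≗g zero) (Σℤ-cong (f≗g ∘ suc))

Σℤ-zero : ∀ {m} {f : Fin m → ℤ} → (∀ i → f i ≡ 0ℤ) → Σℤ f ≡ 0ℤ
Σℤ-zero {zero}  _   = refl
Σℤ-zero {suc m} f≗0 = cong₂ _+_ (f≗0 zero) (Σℤ-zero (f≗0 ∘ suc))

Σℤ-single : ∀ {m} (f : Fin m → ℤ) i → (∀ j → j ≢ i → f j ≡ 0ℤ) → Σℤ f ≡ f i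
Σℤ-single f zero vanish =
  trans (cong (λ rest → f zero + rest) (Σℤ-zero (λ j → vanish (suc j) λ ())))
        (ℤ.+-identityʳ (f zero))
Σℤ-single f (suc i) vanish =
  trans (cong (_+ Σℤ (f ∘ suc)) (vanish zero λ ()))
        (trans (ℤ.+-identityˡ (Σℤ (f ∘ suc)))
               (Σℤ-single (f ∘ suc) i (λ j j≢i → vanish (suc j) (j≢i ∘ suc-injective))))

Σℤ-affine : ∀ {m} x (a b : Fin m → ℤ) →
            Σℤ (λ i → a i * (x * b i - 1ℤ)) ≡ x * Σℤ (λ i → a i * b i) - Σℤ a
Σℤ-affine {zero} x a b = sym (base x)
  where
  base : ∀ x → x * 0ℤ - 0ℤ ≡ 0ℤ
  base = solve-∀
Σℤ-affine {suc m} x a b =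
  trans (cong (λ rest → a zero * (x * b zero - 1ℤ) + rest) (Σℤ-affine x (a ∘ suc) (b ∘ suc)))
        (step x (a zero) (b zero) (Σℤ (λ i → a (suc i) * b (suc i))) (Σℤ (a ∘ suc)))
  where
  step : ∀ x a₀ b₀ B A → a₀ * (x * b₀ - 1ℤ) + (x * B - A) ≡ x * (a₀ * b₀ + B) - (a₀ + A)
  step = solve-∀

δ : ∀ {n} → Fin n → Fin n → ℤ
δ i j = if does (i ≟ j) then 1ℤ else 0ℤ

δ-diag : ∀ {n} (i : Fin n) → δ i i ≡ 1ℤ
δ-diag i = cong (if_then 1ℤ else 0ℤ) (dec-true (i ≟ i) refl)

δ-off : ∀ {n} {i j : Fin n} → i ≢ j → δ i j ≡ 0ℤ
δ-off {i = i} {j} i≢j = cong (if_then 1ℤ else 0ℤ) (dec-false (i ≟ j) i≢j)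

module _ {m n} (s : Fin m → Fin n) (a : Fin m → ℤ) where

  Σℤ-δ-image : Injective _≡_ _≡_ s → ∀ i₀ → Σℤ (λ i → a i * δ (s i) (s i₀)) ≡ a i₀
  Σℤ-δ-image s-inj i₀ = begin
    Σℤ (λ i → a i * δ (s i) (s i₀)) ≡⟨ Σℤ-single _ i₀ off-diagonal ⟩
    a i₀ * δ (s i₀) (s i₀)          ≡⟨ cong (a i₀ *_) (δ-diag (s i₀)) ⟩
    a i₀ * 1ℤ                        ≡⟨ ℤ.*-identityʳ (a i₀) ⟩
    a i₀                             ∎
    where
    open ≡-Reasoning
    off-diagonal : ∀ i → i ≢ i₀ → a i * δ (s i) (s i₀) ≡ 0ℤ
    off-diagonal i i≢i₀ = trans (cong (a i *_) (δ-off (i≢i₀ ∘ s-inj))) (ℤ.*-zeroʳ (a i))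

  Σℤ-δ-missed : ∀ {j} → (∀ i → s i ≢ j) → Σℤ (λ i → a i * δ (s i) j) ≡ 0ℤ
  Σℤ-δ-missed j∉s = Σℤ-zero (λ i → trans (cong (a i *_) (δ-off (j∉s i))) (ℤ.*-zeroʳ (a i)))

injection-misses-point : ∀ {m n} → m < n → (s : Fin m → Fin n) → Injective _≡_ _≡_ s →
                         ∃ λ j → ∀ i → s i ≢ j
injection-misses-point {n = n} m<n s s-inj with all? (λ j → any? (λ i → s i ≟ j))
... | no ¬surjective with ¬∀⟶∃¬ n _ (λ j → any? (λ i → s i ≟ j)) ¬surjective
...   | j , j∉s = j , λ i sᵢ≡j → j∉s (i , sᵢ≡j)
injection-misses-point m<n s s-inj | yes surjective with pigeonhole m<n (proj₁ ∘ surjective)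
... | j₁ , j₂ , j₁<j₂ , same-preimage =
  contradiction (trans (sym (proj₂ (surjective j₁)))
                       (trans (cong s same-preimage) (proj₂ (surjective j₂))))
                (<⇒≢ j₁<j₂)

shifted-identity-rows-independent :
  ∀ {m n} (x : ℤ) → x ≢ 0ℤ → (s : Fin m → Fin n) → Injective _≡_ _≡_ s →
  (∃ λ j → ∀ i → s i ≢ j) → (a : Fin m → ℤ) →
  (∀ j → Σℤ (λ i → a i * (x * δ (s i) j - 1ℤ)) ≡ 0ℤ) → ∀ i → a i ≡ 0ℤ
shifted-identity-rows-independent {n = n} x x≢0 s s-inj (j₀ , j₀∉s) a relation i =
  [ (λ x≡0 → contradiction x≡0 x≢0) , id ]′ (ℤ.i*j≡0⇒i≡0∨j≡0 x x*aᵢ≡0)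
  where
  column : Fin n → ℤ
  column j = Σℤ (λ i → a i * δ (s i) j)

  balanced : ∀ j → x * column j ≡ Σℤ a
  balanced j = ℤ.i-j≡0⇒i≡j _ _ (trans (sym (Σℤ-affine x a (λ i → δ (s i) j))) (relation j))

  total≡0 : Σℤ a ≡ 0ℤ
  total≡0 = trans (sym (balanced j₀)) (trans (cong (x *_) (Σℤ-δ-missed s a j₀∉s)) (ℤ.*-zeroʳ x))

  x*aᵢ≡0 : x * a i ≡ 0ℤ
  x*aᵢ≡0 = trans (cong (x *_) (sym (Σℤ-δ-image s a s-inj i))) (trans (balanced (s i)) total≡0)

module _ {c ℓ p q} (G : Group c ℓ) {H : Group.Carrier G → Set p} {K : Group.Carrier G → Set q}
         (H-normal : IsNormalSubgroup G H) (K-subgroup : IsSubgroup G K) where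

  open Group G using (setoid; _≈_; _∙_; _⁻¹; ε; assoc; ∙-cong; ∙-congˡ; ∙-congʳ; ⁻¹-cong; identityˡ; inverseˡ; inverseʳ)
    renaming (sym to ≈-sym)
  open GroupProperties G using (⁻¹-anti-homo-∙; ⁻¹-involutive)
  open IsNormalSubgroup H-normal using (normal; isSubgroup)
  module H = IsSubgroup isSubgroup
  module K = IsSubgroup K-subgroup

  InProd-⁻¹∙-closed : ∀ {x y} → InProd G H K x → InProd G H K y → InProd G H K (x ⁻¹ ∙ y)
  InProd-⁻¹∙-closed {x} {y} (h , k , h∈H , k∈K , x≈hk) (h′ , k′ , h′∈H , k′∈K , y≈h′k′) =
    (k ⁻¹ ∙ m) ∙ k ⁻¹ ⁻¹ , k ⁻¹ ∙ k′ ,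
    normal (k ⁻¹) (H.∙-closed (H.⁻¹-closed h∈H) h′∈H) ,
    K.∙-closed (K.⁻¹-closed k∈K) k′∈K ,
    factorisation
    where
    open SetoidReasoning setoid
    m = h ⁻¹ ∙ h′
    factorisation : x ⁻¹ ∙ y ≈ ((k ⁻¹ ∙ m) ∙ k ⁻¹ ⁻¹) ∙ (k ⁻¹ ∙ k′)
    factorisation = begin
      x ⁻¹ ∙ y                          ≈⟨ ∙-cong (⁻¹-cong x≈hk) y≈h′k′ ⟩
      (h ∙ k) ⁻¹ ∙ (h′ ∙ k′)            ≈⟨ ∙-congʳ (⁻¹-anti-homo-∙ h k) ⟩
      (k ⁻¹ ∙ h ⁻¹) ∙ (h′ ∙ k′)         ≈⟨ assoc _ _ _ ⟩
      k ⁻¹ ∙ (h ⁻¹ ∙ (h′ ∙ k′))         ≈⟨ ∙-congˡ (assoc _ _ _) ⟨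
      k ⁻¹ ∙ (m ∙ k′)                   ≈⟨ assoc _ _ _ ⟨
      (k ⁻¹ ∙ m) ∙ k′                   ≈⟨ ∙-congˡ (identityˡ k′) ⟨
      (k ⁻¹ ∙ m) ∙ (ε ∙ k′)             ≈⟨ ∙-congˡ (∙-congʳ (inverseʳ k)) ⟨
      (k ⁻¹ ∙ m) ∙ ((k ∙ k ⁻¹) ∙ k′)    ≈⟨ ∙-congˡ (assoc _ _ _) ⟩
      (k ⁻¹ ∙ m) ∙ (k ∙ (k ⁻¹ ∙ k′))    ≈⟨ assoc _ _ _ ⟨
      ((k ⁻¹ ∙ m) ∙ k) ∙ (k ⁻¹ ∙ k′)    ≈⟨ ∙-congʳ (∙-congˡ (⁻¹-involutive k)) ⟨
      ((k ⁻¹ ∙ m) ∙ k ⁻¹ ⁻¹) ∙ (k ⁻¹ ∙ k′) ∎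

  module _ {J t lam} (transversal : IsLeftTransversal G H K J t) (isLambda : IsLambda G H K J lam) where
    open IsLeftTransversal transversal
    open ≡-Reasoning

    lambda-diagonal : ∀ i → lam (t i ⁻¹ ∙ t i) ≡ + J * δ i i - 1ℤ
    lambda-diagonal i = begin
      lam (t i ⁻¹ ∙ t i) ≡⟨ proj₁ (isLambda _) (K.resp (≈-sym (inverseˡ (t i))) K.ε∈) ⟩
      + J - 1ℤ           ≡⟨ cong (_- 1ℤ) (ℤ.*-identityʳ (+ J)) ⟨
      + J * 1ℤ - 1ℤ      ≡⟨ cong (λ d → + J * d - 1ℤ) (δ-diag i) ⟨
      + J * δ i i - 1ℤ   ∎

    lambda-off-diagonal : ∀ {i j} → i ≢ j → lam (t i ⁻¹ ∙ t j) ≡ + J * δ i j - 1ℤ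
    lambda-off-diagonal {i} {j} i≢j = begin
      lam (t i ⁻¹ ∙ t j) ≡⟨ proj₁ (proj₂ (isLambda _)) (InProd-⁻¹∙-closed (inHK i) (inHK j))
                                                        (i≢j ∘ distinct i j) ⟩
      0ℤ - 1ℤ            ≡⟨ cong (_- 1ℤ) (ℤ.*-zeroʳ (+ J)) ⟨
      + J * 0ℤ - 1ℤ      ≡⟨ cong (λ d → + J * d - 1ℤ) (δ-off i≢j) ⟨
      + J * δ i j - 1ℤ   ∎

    lambda-on-transversal : ∀ i j → lam (t i ⁻¹ ∙ t j) ≡ + J * δ i j - 1ℤ
    lambda-on-transversal i j = by-cases (i ≟ j)
      where
      by-cases : Dec (i ≡ j) → lam (t i ⁻¹ ∙ t j) ≡ + J * δ i j - 1ℤ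
      by-cases (yes refl) = lambda-diagonal i
      by-cases (no i≢j)   = lambda-off-diagonal i≢j

lemma3p2 : ∀ {c ℓ p q : Level} (G : Group c ℓ) → IsFinite G →
    (H : Group.Carrier G → Set p) (K : Group.Carrier G → Set q) →
    IsNormalSubgroup G H → IsSubgroup G K →
    ((∀ g → H g → K g → Group._≈_ G g (Group.ε G)) ⊎ (∀ g → K g → H g)) →
    (J : ℕ) (t : Fin J → Group.Carrier G) → IsLeftTransversal G H K J t →
    (lam : Group.Carrier G → ℤ) → IsLambda G H K J lam →
    (s : Fin (J ∸ 1) → Fin J) → Injective _≡_ _≡_ s →
    LinIndepℤ G (λ i → translate G (t (s i)) lam)
lemma3p2 G _ H K _ _ _ zero t _ lam _ s _ a _ ()
lemma3p2 G _ H K H-normal K-subgroup _ (suc J) t transversal lam isLambda s s-inj a relation =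
  shifted-identity-rows-independent (+ suc J) (λ ()) s s-inj
    (injection-misses-point (ℕ.n<1+n J) s s-inj) a columns
  where
  columns : ∀ j → Σℤ (λ i → a i * (+ suc J * δ (s i) j - 1ℤ)) ≡ 0ℤ
  columns j = trans
    (Σℤ-cong (λ i → cong (a i *_)
      (sym (lambda-on-transversal G H-normal K-subgroup transversal isLambda (s i) j))))
    (relation (t j))
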